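{- Let $n>2$ be an integer and $r\ge1$ an integer with $2^r+1<2^n$, and let $S=P_{2^r+1}(n)$. Then $S$ satisfies Wilf's inequality: $\mathrm{F}(S)+1\le \mathrm{e}(S)\,\nu(S)$, where $\nu(S)=|\{s\in S\mid s\le \mathrm{F}(S)\}|$.
   Context: $P_{2^r+1}(n)$ is the numerical semigroup consisting of all finite non-negative integer linear combinations of $\{(2^r+1)2^{n+i}+1\mid i\in\mathbb{N}\}$. $\mathrm{F}(S)$ is the Frobenius number (largest integer not in $S$) and $\mathrm{e}(S)$ is the embedding dimension (cardinality of the unique minimal system of generators of $S$). -}

module Defs where

open import Data.Nat using (ℕ; zero; suc; _+_; _*_; _^_; _≤_; _<_)
open import Data.Product using (Σ; ∃; _×_; _,_)
open import Data.List using (List; length)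
open import Data.List.Membership.Propositional using (_∈_)
open import Data.List.Relation.Unary.Unique.Propositional using (Unique)
open import Relation.Binary.PropositionalEquality using (_≡_)
open import Relation.Nullary using (¬_)
open import Function.Bundles using (_⇔_)

data Gen (A : ℕ → Set) : ℕ → Set where
  gen-zero : Gen A 0
  gen-add  : ∀ {x a} → Gen A x → A a → Gen A (x + a)

IsPGenerator : (r n : ℕ) → ℕ → Set
IsPGenerator r n a = ∃ λ i → a ≡ (2 ^ r + 1) * 2 ^ (n + i) + 1

P : (r n : ℕ) → ℕ → Set
P r n = Gen (IsPGenerator r n)

IsFrobenius : (S : ℕ → Set) → ℕ → Set
IsFrobenius S F = ¬ S F × (∀ x → F < x → S x)

Generates : (S : ℕ → Set) → List ℕ → Set
Generates S L = ∀ x → Gen (λ a → a ∈ L) x ⇔ S x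

IsMinimalGeneratingSystem : (S : ℕ → Set) → List ℕ → Set
IsMinimalGeneratingSystem S L =
  Unique L × Generates S L ×
  ((L' : List ℕ) → (∀ a → a ∈ L' → a ∈ L) → Generates S L' →
     ∀ a → a ∈ L → a ∈ L')

IsEmbeddingDimension : (S : ℕ → Set) → ℕ → Set
IsEmbeddingDimension S e =
  Σ (List ℕ) λ L → IsMinimalGeneratingSystem S L × length L ≡ e

IsNu : (S : ℕ → Set) → (F ν : ℕ) → Set
IsNu S F ν =
  Σ (List ℕ) λ L → Unique L × (∀ s → s ∈ L ⇔ (S s × s ≤ F)) × length L ≡ ν

{-# OPTIONS --safe #-}
module Submission where

-- Write M = (2^r + 1) 2^n, so that the generators are g i = M 2^i + 1. A sum of k generators
-- g i₁ + ⋯ + g iₖ is M s + k with s = 2^i₁ + ⋯ + 2^iₖ, hence k ≤ s; conversely, splitting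
-- 2^(i+1) = 2^i + 2^i realises every k′ between k and s with the same s.
-- F = M (M + 3) + 3: it is not in S because M + 3 = 2^(n+r) + 2^n + 2 + 1 is not a sum of three
-- powers of two, while M (M + 3) + 4, …, M (M + 4) + 4 are in S and adding g 0 = M + 1 reaches
-- everything larger. The generators g 0, …, g (n + r) are not sums of two or more elements
-- (M s + k with 2 ≤ k ≤ s never equals M 2^i + 1 when 2^i ≤ M), and all later ones exceed F,
-- so e = n + r + 1 ≥ 5. With M = 2T, the blocks M s + [⌈s/2⌉, s] for s < M give ν ≥ T (T + 1),
-- and 2T (2T + 3) + 4 ≤ 5 T (T + 1).

open import Defs
open import Data.Nat
  using (ℕ; zero; suc; _+_; _*_; _∸_; _^_; _≤_; _<_; _≤′_; ≤′-refl; ≤′-step;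
         z≤n; s≤s; z<s; _≤?_; _<?_; NonZero; >-nonZero; _/_; _%_)
open import Data.Nat.Properties
open import Data.Nat.DivMod using (m≡m%n+[m/n]*n; m%n<n)
open import Data.Nat.Induction using (<-rec)
open import Data.Nat.Tactic.RingSolver using (solve-∀)
open import Data.Product using (Σ; _×_; _,_; proj₁; proj₂)
open import Data.Sum using (_⊎_; inj₁; inj₂)
open import Data.Empty using (⊥-elim)
open import Data.List using (List; length; map; filter; downFrom)
open import Data.List.Properties using (filter-accept; length-map; length-downFrom)
import Data.List.Relation.Unary.Unique.Propositional.Properties as Unique
open import Data.List.Membership.Propositional.Properties
  using (∈-map⁺; ∈-map⁻; ∈-downFrom⁺; ∈-downFrom⁻; ∈-filter⁺; ∈-filter⁻)
open import Data.List.Membership.Propositional using (_∈_; find; lose)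
open import Data.List.Relation.Unary.All as All using (All)
open import Data.List.Relation.Unary.Any using (Any; any?)
open import Function using (_∘_)
open import Function.Bundles using (mk⇔; Equivalence)
open import Relation.Binary.PropositionalEquality
open import Relation.Binary.Definitions using (tri<; tri≈; tri>)
open import Relation.Nullary using (¬_; Dec; yes; no)
open import Relation.Nullary.Decidable using (map′)
open import Relation.Unary using (Decidable; U)

-- Sums of powers of two

data PowerSum (B : ℕ → Set) : ℕ → ℕ → Set where
  empty : PowerSum B 0 0
  add   : ∀ {k s} i → B i → PowerSum B k s → PowerSum B (suc k) (s + 2 ^ i)

2^j+2^j≡2^[1+j] : ∀ j → 2 ^ j + 2 ^ j ≡ 2 ^ suc j
2^j+2^j≡2^[1+j] j = cong (2 ^ j +_) (sym (+-identityʳ (2 ^ j)))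

DownClosed : (ℕ → Set) → Set
DownClosed B = ∀ {i} → B (suc i) → B i

even-or-odd : ∀ n → Σ ℕ λ h → n ≡ 2 * h ⊎ n ≡ suc (2 * h)
even-or-odd zero = 0 , inj₁ refl
even-or-odd (suc n) with even-or-odd n
... | h , inj₁ n≡2h = h , inj₂ (cong suc n≡2h)
... | h , inj₂ n≡1+2h = suc h , inj₁ (trans (cong suc n≡1+2h) (sym (*-suc 2 h)))

module _ {B : ℕ → Set} where

  PowerSum⇒count≤sum : ∀ {k s} → PowerSum B k s → k ≤ s
  PowerSum⇒count≤sum empty = z≤n
  PowerSum⇒count≤sum {suc k} (add {s = s} i _ p) =
    subst (_≤ s + 2 ^ i) (+-comm k 1) (+-mono-≤ (PowerSum⇒count≤sum p) (m^n>0 2 i))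

  PowerSum-split : DownClosed B → ∀ {k s} → PowerSum B k s → k < s → PowerSum B (suc k) s
  PowerSum-split down {suc k} (add {s = s} zero b p) k<s =
    add zero b (PowerSum-split down p (≤-pred (subst (suc (suc k) ≤_) (+-comm s 1) k<s)))
  PowerSum-split down (add {s = s} (suc j) b p) _ =
    subst (PowerSum B _) (trans (+-assoc s (2 ^ j) (2 ^ j)) (cong (s +_) (2^j+2^j≡2^[1+j] j)))
      (add j (down b) (add j (down b) p))

  PowerSum-refine : DownClosed B → ∀ {k k′ s} → PowerSum B k s → k ≤′ k′ → k′ ≤ s →
                    PowerSum B k′ s
  PowerSum-refine down p ≤′-refl _ = p
  PowerSum-refine down p (≤′-step k≤′k′) k′<s =
    PowerSum-split down (PowerSum-refine down p k≤′k′ (<⇒≤ k′<s)) k′<s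

  PowerSum-one : ∀ {s} → PowerSum B 1 s → Σ ℕ λ i → s ≡ 2 ^ i
  PowerSum-one (add i _ empty) = i , refl

  PowerSum-odd : ∀ {k s q} → PowerSum B k s → s ≡ suc (2 * q) →
                 Σ ℕ λ k′ → k ≡ suc k′ × PowerSum B k′ (2 * q)
  PowerSum-odd (add {k} {s} zero _ p) eq =
    k , refl , subst (PowerSum B k) (suc-injective (trans (sym (+-comm s 1)) eq)) p
  PowerSum-odd {q = q} (add {s = s} (suc j) b p) eq with even-or-odd s
  ... | h , inj₁ s≡2h =
    ⊥-elim (even≢odd (h + 2 ^ j) q
      (trans (*-distribˡ-+ 2 h (2 ^ j)) (trans (cong (_+ 2 * 2 ^ j) (sym s≡2h)) eq)))
  ... | h , inj₂ s≡1+2h with PowerSum-odd {q = h} p s≡1+2h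
  ...   | k′ , refl , p′ =
    suc k′ , refl ,
    subst (PowerSum B (suc k′)) (suc-injective (trans (cong (_+ 2 * 2 ^ j) (sym s≡1+2h)) eq))
      (add (suc j) b p′)

  PowerSum-halve₂ : ∀ {s q} → PowerSum B 2 s → s ≡ 2 * q → q ≡ 1 ⊎ PowerSum (B ∘ suc) 2 q
  PowerSum-halve₂ {q = q} (add zero _ (add zero _ empty)) eq = inj₁ (*-cancelˡ-≡ q 1 2 (sym eq))
  PowerSum-halve₂ {q = q} (add zero _ (add (suc j) _ empty)) eq =
    ⊥-elim (even≢odd q (2 ^ j) (sym (trans (sym (+-comm (2 * 2 ^ j) 1)) eq)))
  PowerSum-halve₂ {q = q} (add (suc i) _ (add zero _ empty)) eq =
    ⊥-elim (even≢odd q (2 ^ i) (sym eq))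
  PowerSum-halve₂ {q = q} (add (suc i) bᵢ (add (suc j) bⱼ empty)) eq =
    inj₂ (subst (PowerSum (B ∘ suc) 2)
            (*-cancelˡ-≡ _ q 2 (trans (*-distribˡ-+ 2 (2 ^ j) (2 ^ i)) eq))
            (add i bᵢ (add j bⱼ empty)))

-- 8W + 3 = 1 + 2 (4W + 1) and 4W + 1 = 1 + 2 (2W): peel off a term 2^0, halve the remaining
-- two terms, peel off another 2^0; the last term is 4W.
PowerSum-8W+3 : ∀ {B W} → 1 ≤ W → PowerSum B 3 (8 * W + 3) → Σ ℕ λ i → 4 * W ≡ 2 ^ i
PowerSum-8W+3 {B} {W} 1≤W p = dropOne (PowerSum-odd {q = 4 * W + 1} p (8W+3≡ W))
  where
    8W+3≡ : ∀ W → 8 * W + 3 ≡ suc (2 * (4 * W + 1))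
    8W+3≡ = solve-∀
    4W+1≡ : ∀ W → 4 * W + 1 ≡ suc (2 * (2 * W))
    4W+1≡ = solve-∀
    4W≡ : ∀ W → 4 * W ≡ 2 * (2 * W)
    4W≡ = solve-∀

    dropOneAgain : ∀ {B′} → (Σ ℕ λ k → 2 ≡ suc k × PowerSum B′ k (2 * (2 * W))) →
                   Σ ℕ λ i → 4 * W ≡ 2 ^ i
    dropOneAgain (_ , refl , p₁) with PowerSum-one p₁
    ... | i , 2[2W]≡2^i = i , trans (4W≡ W) 2[2W]≡2^i

    dropOne : (Σ ℕ λ k → 3 ≡ suc k × PowerSum B k (2 * (4 * W + 1))) → Σ ℕ λ i → 4 * W ≡ 2 ^ i
    dropOne (_ , refl , p₂) with PowerSum-halve₂ p₂ refl
    ... | inj₁ 4W+1≡1 =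
      ⊥-elim (<⇒≢ (≤-trans (s≤s z≤n) (*-monoʳ-≤ 4 1≤W)) (sym (+-cancelʳ-≡ 1 (4 * W) 0 4W+1≡1)))
    ... | inj₂ p₂′ = dropOneAgain (PowerSum-odd {q = 2 * W} p₂′ (4W+1≡ W))

2^i≢2^j*odd : ∀ i j q → 1 ≤ q → 2 ^ i ≢ 2 ^ j * suc (2 * q)
2^i≢2^j*odd zero zero q 1≤q eq =
  <⇒≢ (≤-trans (s≤s z≤n) (*-monoʳ-≤ 2 1≤q)) (suc-injective (trans eq (*-identityˡ _)))
2^i≢2^j*odd zero (suc j) q _ eq =
  even≢odd (2 ^ j * suc (2 * q)) 0 (sym (trans eq (*-assoc 2 (2 ^ j) _)))
2^i≢2^j*odd (suc i) zero q _ eq = even≢odd (2 ^ i) q (trans eq (*-identityˡ _))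
2^i≢2^j*odd (suc i) (suc j) q 1≤q eq =
  2^i≢2^j*odd i j q 1≤q (*-cancelˡ-≡ (2 ^ i) _ 2 (trans eq (*-assoc 2 (2 ^ j) _)))

-- Submonoids of ℕ generated by a set

module _ {A : ℕ → Set} where

  Gen-+ : ∀ {x y} → Gen A x → Gen A y → Gen A (x + y)
  Gen-+ {x} gx gen-zero = subst (Gen A) (sym (+-identityʳ x)) gx
  Gen-+ {x} gx (gen-add {y} {a} gy ga) = subst (Gen A) (+-assoc x y a) (gen-add (Gen-+ gx gy) ga)

  Gen-singleton : ∀ {a} → A a → Gen A a
  Gen-singleton = gen-add gen-zero

  Gen-≥ : ∀ {b d} .{{_ : NonZero d}} → Gen A d → (∀ t → t < d → Gen A (b + t)) →
          ∀ x → b ≤ x → Gen A x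
  Gen-≥ {b} {d} gd interval x b≤x =
    subst (Gen A) b+y≡x (subst (λ z → Gen A (b + z)) (sym (m≡m%n+[m/n]*n y d)) (shifted (y / d)))
    where
      y = x ∸ b
      b+y≡x : b + y ≡ x
      b+y≡x = m+[n∸m]≡n b≤x
      shifted : ∀ q → Gen A (b + (y % d + q * d))
      shifted zero =
        subst (λ z → Gen A (b + z)) (sym (+-identityʳ _)) (interval (y % d) (m%n<n y d))
      shifted (suc q) = subst (Gen A) (reassoc b (y % d) (q * d) d) (Gen-+ (shifted q) gd)
        where reassoc : ∀ b r e d → b + (r + e) + d ≡ b + (r + (d + e))
              reassoc = solve-∀

Gen-bind : ∀ {A A′ : ℕ → Set} → (∀ {a} → A a → Gen A′ a) → ∀ {x} → Gen A x → Gen A′ x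
Gen-bind f gen-zero = gen-zero
Gen-bind f (gen-add g a) = Gen-+ (Gen-bind f g) (f a)

-- The last generator used is positive, so it can be removed by well-founded recursion.
Gen-dec : ∀ {L} → All (0 <_) L → Decidable (Gen (_∈ L))
Gen-dec {L} positive = <-rec (λ x → Dec (Gen (_∈ L) x)) step
  where
    LastGenerator : ℕ → ℕ → Set
    LastGenerator x a = 0 < a × a ≤ x × Gen (_∈ L) (x ∸ a)

    step : ∀ x → (∀ {y} → y < x → Dec (Gen (_∈ L) y)) → Dec (Gen (_∈ L) x)
    step zero _ = yes gen-zero
    step x@(suc _) rec = map′ fromLast (toLast refl) (any? last? L)
      where
        last? : ∀ a → Dec (LastGenerator x a)
        last? a with 0 <? a | a ≤? x
        ... | yes 0<a | yes a≤x =
          map′ (λ g → 0<a , a≤x , g) (proj₂ ∘ proj₂) (rec (∸-monoʳ-< 0<a a≤x))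
        ... | no 0≮a | _ = no (0≮a ∘ proj₁)
        ... | yes _ | no a≰x = no (a≰x ∘ proj₁ ∘ proj₂)

        fromLast : Any (LastGenerator x) L → Gen (_∈ L) x
        fromLast any with find any
        ... | a , a∈L , _ , a≤x , g = subst (Gen (_∈ L)) (m∸n+n≡m a≤x) (gen-add g a∈L)

        toLast : ∀ {z} → z ≡ x → Gen (_∈ L) z → Any (LastGenerator x) L
        toLast () gen-zero
        toLast y+a≡x (gen-add {y} {a} g a∈L) =
          lose a∈L (All.lookup positive a∈L , subst (a ≤_) y+a≡x (m≤n+m a y) ,
                    subst (Gen (_∈ L)) (trans (sym (m+n∸n≡m y a)) (cong (_∸ a) y+a≡x)) g)

module Count {Q : ℕ → Set} (Q? : Decidable Q) where

  count : ℕ → ℕ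
  count N = length (filter Q? (downFrom N))

  count-suc : ∀ N → count N ≤ count (suc N)
  count-suc N with Q? N
  ... | yes _ = n≤1+n _
  ... | no _ = ≤-refl

  count-mono : ∀ {N N′} → N ≤ N′ → count N ≤ count N′
  count-mono = mono ∘ ≤⇒≤′
    where mono : ∀ {N N′} → N ≤′ N′ → count N ≤ count N′
          mono ≤′-refl = ≤-refl
          mono (≤′-step N≤′N′) = ≤-trans (mono N≤′N′) (count-suc _)

  count-interval : ∀ b j → (∀ t → t < j → Q (b + t)) → count b + j ≤ count (b + j)
  count-interval b zero _ = ≤-reflexive (trans (+-identityʳ _) (cong count (sym (+-identityʳ b))))
  count-interval b (suc j) interval = begin
    count b + suc j           ≡⟨ +-suc (count b) j ⟩
    suc (count b + j)         ≤⟨ s≤s (count-interval b j (λ t → interval t ∘ m<n⇒m<1+n)) ⟩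
    suc (count (b + j))       ≡⟨ cong length (sym (filter-accept Q? (interval j ≤-refl))) ⟩
    count (suc (b + j))       ≡⟨ cong count (sym (+-suc b j)) ⟩
    count (b + suc j)         ∎
    where open ≤-Reasoning

m*s+k≢m*d+1 : ∀ m d s k → d ≤ m → 2 ≤ k → k ≤ s → m * s + k ≢ m * d + 1
m*s+k≢m*d+1 m d s k d≤m 2≤k k≤s eq with ≤-<-connex d s
... | inj₁ d≤s = <⇒≢ (begin-strict
  m * d + 1 <⟨ +-monoʳ-< (m * d) 2≤k ⟩
  m * d + k ≤⟨ +-monoˡ-≤ k (*-monoʳ-≤ m d≤s) ⟩
  m * s + k ∎) (sym eq)
  where open ≤-Reasoning
... | inj₂ s<d = <⇒≢ (begin-strict
  m * s + k     <⟨ +-monoʳ-< (m * s) (≤-<-trans k≤s (<-≤-trans s<d d≤m)) ⟩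
  m * s + m     ≡⟨ trans (+-comm (m * s) m) (sym (*-suc m s)) ⟩
  m * suc s     ≤⟨ *-monoʳ-≤ m s<d ⟩
  m * d         <⟨ m<m+n (m * d) z<s ⟩
  m * d + 1     ∎) eq
  where open ≤-Reasoning

m*[m+3]+3<m*[m+4] : ∀ m → 4 ≤ m → m * (m + 3) + 3 < m * (m + 4)
m*[m+3]+3<m*[m+4] m 4≤m = subst (m * (m + 3) + 3 <_) (expand m) (+-monoʳ-< (m * (m + 3)) 4≤m)
  where expand : ∀ m → m * (m + 3) + m ≡ m * (m + 4)
        expand = solve-∀

m*s+k≡m*[m+3]+3⇒s≡m+3 : ∀ m s k → 4 ≤ m → k ≤ s → m * s + k ≡ m * (m + 3) + 3 →
                        s ≡ m + 3
m*s+k≡m*[m+3]+3⇒s≡m+3 m s k 4≤m k≤s eq with <-cmp s (m + 3)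
... | tri≈ _ s≡m+3 _ = s≡m+3
... | tri< s<m+3 _ _ = ⊥-elim (<⇒≢ (begin-strict
  m * s + k             ≤⟨ +-mono-≤ (*-monoʳ-≤ m s≤m+2) (≤-trans k≤s s≤m+2) ⟩
  m * (m + 2) + (m + 2) ≡⟨ expand m ⟩
  m * (m + 3) + 2       <⟨ +-monoʳ-< (m * (m + 3)) ≤-refl ⟩
  m * (m + 3) + 3       ∎) eq)
  where
    open ≤-Reasoning
    s≤m+2 : s ≤ m + 2
    s≤m+2 = ≤-pred (subst (suc s ≤_) (+-suc m 2) s<m+3)
    expand : ∀ m → m * (m + 2) + (m + 2) ≡ m * (m + 3) + 2
    expand = solve-∀
... | tri> _ _ m+3<s = ⊥-elim (<⇒≢ (begin-strict
  m * (m + 3) + 3 <⟨ m*[m+3]+3<m*[m+4] m 4≤m ⟩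
  m * (m + 4)     ≤⟨ *-monoʳ-≤ m (subst (_≤ s) (sym (+-suc m 3)) m+3<s) ⟩
  m * s           ≤⟨ m≤m+n (m * s) k ⟩
  m * s + k       ∎) (sym eq))
  where open ≤-Reasoning

-- The semigroup P_{2^r+1}(n), with r = 1 + r′ and n = 3 + n′

module Semigroup (r′ n′ : ℕ) where

  r n c M F : ℕ
  r = suc r′
  n = 3 + n′
  c = n + r
  M = (2 ^ r + 1) * 2 ^ n
  F = M * (M + 3) + 3

  S : ℕ → Set
  S = P r n

  g : ℕ → ℕ
  g i = M * 2 ^ i + 1

  g-isGenerator : ∀ i → IsPGenerator r n (g i)
  g-isGenerator i =
    i , cong (_+ 1) (trans (*-assoc (2 ^ r + 1) (2 ^ n) (2 ^ i))
                           (cong ((2 ^ r + 1) *_) (sym (^-distribˡ-+-* 2 n i))))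

  generator⇒g : ∀ {a} → IsPGenerator r n a → Σ ℕ λ i → a ≡ g i
  generator⇒g (i , a≡) = i , trans a≡ (sym (proj₂ (g-isGenerator i)))

  W : ℕ
  W = (2 ^ r + 1) * 2 ^ n′

  M≡8W : M ≡ 8 * W
  M≡8W = identity (2 ^ r + 1) (2 ^ n′)
    where identity : ∀ m p → m * (2 * (2 * (2 * p))) ≡ 8 * (m * p)
          identity = solve-∀

  3≤W : 3 ≤ W
  3≤W = *-mono-≤ (+-monoˡ-≤ 1 (*-monoʳ-≤ 2 (m^n>0 2 r′))) (m^n>0 2 n′)

  4≤M : 4 ≤ M
  4≤M = subst (4 ≤_) (sym M≡8W) (≤-trans (m≤m+n 4 4) (*-monoʳ-≤ 8 (≤-trans (s≤s z≤n) 3≤W)))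

  instance
    M-nonZero : NonZero M
    M-nonZero = >-nonZero (≤-trans (s≤s z≤n) 4≤M)

  M≡2^c+2^n : M ≡ 2 ^ c + 2 ^ n
  M≡2^c+2^n = begin
    (2 ^ r + 1) * 2 ^ n       ≡⟨ *-distribʳ-+ (2 ^ n) (2 ^ r) 1 ⟩
    2 ^ r * 2 ^ n + 1 * 2 ^ n ≡⟨ cong₂ _+_ (*-comm (2 ^ r) (2 ^ n)) (*-identityˡ (2 ^ n)) ⟩
    2 ^ n * 2 ^ r + 2 ^ n     ≡⟨ cong (_+ 2 ^ n) (sym (^-distribˡ-+-* 2 n r)) ⟩
    2 ^ c + 2 ^ n             ∎
    where open ≡-Reasoning

  2^i≤M : ∀ {i} → i ≤ c → 2 ^ i ≤ M
  2^i≤M {i} i≤c =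
    ≤-trans (^-monoʳ-≤ 2 i≤c) (≤-trans (m≤m+n (2 ^ c) (2 ^ n)) (≤-reflexive (sym M≡2^c+2^n)))

  M+4≤2^[1+c] : M + 4 ≤ 2 ^ suc c
  M+4≤2^[1+c] = begin
    M + 4                   ≡⟨ cong (_+ 4) M≡2^c+2^n ⟩
    2 ^ c + 2 ^ n + 4       ≤⟨ +-monoʳ-≤ (2 ^ c + 2 ^ n) (^-monoʳ-≤ 2 {2} {n} (s≤s (s≤s z≤n))) ⟩
    2 ^ c + 2 ^ n + 2 ^ n   ≡⟨ +-assoc (2 ^ c) (2 ^ n) (2 ^ n) ⟩
    2 ^ c + (2 ^ n + 2 ^ n) ≡⟨ cong (2 ^ c +_) (2^j+2^j≡2^[1+j] n) ⟩
    2 ^ c + 2 ^ suc n       ≤⟨ +-monoʳ-≤ (2 ^ c) (^-monoʳ-≤ 2 (m<m+n n z<s)) ⟩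
    2 ^ c + 2 ^ c           ≡⟨ 2^j+2^j≡2^[1+j] c ⟩
    2 ^ suc c               ∎
    where open ≤-Reasoning

  g-<-mono : ∀ {i j} → i < j → g i < g j
  g-<-mono i<j = +-monoˡ-< 1 (*-monoʳ-< M (^-monoʳ-< 2 (s≤s (s≤s z≤n)) i<j))

  g-injective : ∀ {i j} → g i ≡ g j → i ≡ j
  g-injective {i} {j} eq with <-cmp i j
  ... | tri< i<j _ _ = ⊥-elim (<⇒≢ (g-<-mono i<j) eq)
  ... | tri≈ _ i≡j _ = i≡j
  ... | tri> _ _ j<i = ⊥-elim (<⇒≢ (g-<-mono j<i) (sym eq))

  F<g : ∀ {i} → c < i → F < g i
  F<g {i} c<i = begin-strict
    M * (M + 3) + 3 <⟨ m*[m+3]+3<m*[m+4] M 4≤M ⟩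
    M * (M + 4)     ≤⟨ *-monoʳ-≤ M (≤-trans M+4≤2^[1+c] (^-monoʳ-≤ 2 c<i)) ⟩
    M * 2 ^ i       <⟨ m<m+n (M * 2 ^ i) z<s ⟩
    g i             ∎
    where open ≤-Reasoning

  M*s+k+g≡ : ∀ {x s k} i → x ≡ M * s + k → x + g i ≡ M * (s + 2 ^ i) + suc k
  M*s+k+g≡ {x} {s} {k} i x≡ = trans (cong (_+ g i) x≡) (expand M s k (2 ^ i))
    where expand : ∀ m s k e → m * s + k + (m * e + 1) ≡ m * (s + e) + suc k
          expand = solve-∀

  S⇒PowerSum : ∀ {x} → S x → Σ ℕ λ k → Σ ℕ λ s → x ≡ M * s + k × PowerSum U k s
  S⇒PowerSum gen-zero = 0 , 0 , sym (trans (+-identityʳ _) (*-zeroʳ M)) , empty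
  S⇒PowerSum (gen-add sy a) with S⇒PowerSum sy | generator⇒g a
  ... | k , s , y≡ , p | i , refl = suc k , s + 2 ^ i , M*s+k+g≡ i y≡ , add i _ p

  L : List ℕ
  L = map g (downFrom (suc c))

  g∈L : ∀ {i} → i ≤ c → g i ∈ L
  g∈L i≤c = ∈-map⁺ g (∈-downFrom⁺ (s≤s i≤c))

  ∈L⇒g : ∀ {a} → a ∈ L → Σ ℕ λ i → i ≤ c × a ≡ g i
  ∈L⇒g a∈L = let i , i∈ , a≡ = ∈-map⁻ g a∈L in i , ≤-pred (∈-downFrom⁻ i∈) , a≡

  ∈L⇒generator : ∀ {a} → a ∈ L → IsPGenerator r n a
  ∈L⇒generator a∈L =
    let i , _ , a≡ = ∈L⇒g a∈L in subst (IsPGenerator r n) (sym a≡) (g-isGenerator i)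

  GL : ℕ → Set
  GL = Gen (_∈ L)

  GL⇒S : ∀ {x} → GL x → S x
  GL⇒S = Gen-bind (Gen-singleton ∘ ∈L⇒generator)

  PowerSum⇒GL : ∀ {k s} → PowerSum (_≤ c) k s → GL (M * s + k)
  PowerSum⇒GL empty = subst GL (sym (trans (+-identityʳ _) (*-zeroʳ M))) gen-zero
  PowerSum⇒GL (add i i≤c p) = subst GL (M*s+k+g≡ i refl) (gen-add (PowerSum⇒GL p) (g∈L i≤c))

  M+3-four-powers : PowerSum (_≤ c) 4 (M + 3)
  M+3-four-powers =
    subst (PowerSum (_≤ c) 4) (trans (cong (λ e → e + 2 + 1) (sym M≡2^c+2^n)) (+-assoc M 2 1))
      (add 0 z≤n (add 1 (s≤s z≤n) (add n (m≤m+n n r) (add c ≤-refl empty))))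

  M+4-three-powers : PowerSum (_≤ c) 3 (M + 4)
  M+4-three-powers =
    subst (PowerSum (_≤ c) 3) (cong (_+ 4) (sym M≡2^c+2^n))
      (add 2 (s≤s (s≤s z≤n)) (add n (m≤m+n n r) (add c ≤-refl empty)))

  M+3-not-three-powers : ¬ PowerSum U 3 (M + 3)
  M+3-not-three-powers p
    with PowerSum-8W+3 (≤-trans (s≤s z≤n) 3≤W) (subst (PowerSum U 3) (cong (_+ 3) M≡8W) p)
  ... | i , 4W≡2^i =
    2^i≢2^j*odd i (2 + n′) (2 ^ r′) (m^n>0 2 r′) (trans (sym 4W≡2^i) (regroup (2 ^ r′) (2 ^ n′)))
    where regroup : ∀ q p → 4 * ((2 * q + 1) * p) ≡ 2 * (2 * p) * (1 + 2 * q)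
          regroup = solve-∀

  F∉S : ¬ S F
  F∉S sF with S⇒PowerSum sF
  ... | k , s , F≡ , p with m*s+k≡m*[m+3]+3⇒s≡m+3 M s k 4≤M (PowerSum⇒count≤sum p) (sym F≡)
  ...   | refl = M+3-not-three-powers (subst (λ k → PowerSum U k (M + 3)) k≡3 p)
    where k≡3 : k ≡ 3
          k≡3 = +-cancelˡ-≡ (M * (M + 3)) k 3 (sym F≡)

  F+1+t∈GL : ∀ t → t < suc M → GL (suc F + t)
  F+1+t∈GL t t≤M with m≤n⇒m<n∨m≡n (≤-pred t≤M)
  ... | inj₁ t<M = subst GL (regroup M t)
          (PowerSum⇒GL (PowerSum-refine <⇒≤ M+3-four-powers (≤⇒≤′ (m≤m+n 4 t)) 4+t≤M+3))
    where
      4+t≤M+3 : 4 + t ≤ M + 3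
      4+t≤M+3 = subst (4 + t ≤_) (+-comm 3 M) (+-monoʳ-≤ 3 t<M)
      regroup : ∀ m t → m * (m + 3) + (4 + t) ≡ suc (m * (m + 3) + 3 + t)
      regroup = solve-∀
  ... | inj₂ refl = subst GL (regroup M)
          (PowerSum⇒GL (PowerSum-refine <⇒≤ M+4-three-powers (≤⇒≤′ (n≤1+n 3)) (m≤n+m 4 M)))
    where regroup : ∀ m → m * (m + 4) + 4 ≡ suc (m * (m + 3) + 3 + m)
          regroup = solve-∀

  -- The M + 1 consecutive elements F + 1, …, F + 1 + M and g 0 = M + 1 give everything above F.
  F<x⇒GL : ∀ x → F < x → GL x
  F<x⇒GL = Gen-≥ (Gen-singleton g0∈L) F+1+t∈GL
    where g0∈L : suc M ∈ L
          g0∈L = subst (_∈ L) (trans (cong (_+ 1) (*-identityʳ M)) (+-comm M 1)) (g∈L z≤n)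

  S⇒GL : ∀ {x} → S x → GL x
  S⇒GL = Gen-bind generator∈GL
    where
      generator∈GL : ∀ {a} → IsPGenerator r n a → GL a
      generator∈GL a with generator⇒g a
      ... | i , refl with i ≤? c
      ...   | yes i≤c = Gen-singleton (g∈L i≤c)
      ...   | no i≰c = F<x⇒GL (g i) (F<g (≰⇒> i≰c))

  frobenius : IsFrobenius S F
  frobenius = F∉S , λ x F<x → GL⇒S (F<x⇒GL x F<x)

  L-generates : Generates S L
  L-generates x = mk⇔ GL⇒S S⇒GL

  g-indecomposable : ∀ {y a b i} → S y → IsPGenerator r n a → IsPGenerator r n b → i ≤ c →
                     y + a + b ≢ g i
  g-indecomposable {i = i} sy a b i≤c eq with S⇒PowerSum sy | generator⇒g a | generator⇒g b
  ... | k , s , y≡ , p | j , refl | l , refl =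
    m*s+k≢m*d+1 M (2 ^ i) (s + 2 ^ j + 2 ^ l) (2 + k) (2^i≤M i≤c) (s≤s (s≤s z≤n))
      (PowerSum⇒count≤sum (add l _ (add j _ p)))
      (trans (sym (M*s+k+g≡ l (M*s+k+g≡ j y≡))) eq)

  L-minimal : (L′ : List ℕ) → (∀ a → a ∈ L′ → a ∈ L) → Generates S L′ → ∀ a → a ∈ L → a ∈ L′
  L-minimal L′ L′⊆L L′-generates a a∈L with ∈L⇒g a∈L
  ... | i , i≤c , refl =
    g∈L′ refl (Equivalence.from (L′-generates (g i)) (Gen-singleton (g-isGenerator i)))
    where
      generator : ∀ {a} → a ∈ L′ → IsPGenerator r n a
      generator = ∈L⇒generator ∘ L′⊆L _

      g∈L′ : ∀ {x} → x ≡ g i → Gen (_∈ L′) x → g i ∈ L′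
      g∈L′ 0≡g gen-zero = ⊥-elim (0≢1+n (trans 0≡g (+-comm (M * 2 ^ i) 1)))
      g∈L′ a≡g (gen-add gen-zero a∈L′) = subst (_∈ L′) a≡g a∈L′
      g∈L′ x≡g (gen-add (gen-add gy a∈L′) b∈L′) =
        ⊥-elim (g-indecomposable (Gen-bind (Gen-singleton ∘ generator) gy)
                                 (generator a∈L′) (generator b∈L′) i≤c x≡g)

  embedding-dimension : IsEmbeddingDimension S (suc c)
  embedding-dimension =
    L , (Unique.map⁺ g-injective (Unique.downFrom⁺ (suc c)) , L-generates , L-minimal) ,
    trans (length-map g (downFrom (suc c))) (length-downFrom (suc c))

  S? : Decidable S
  S? x = map′ GL⇒S S⇒GL (Gen-dec (All.tabulate positive) x)
    where positive : ∀ {a} → a ∈ L → 0 < a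
          positive a∈L = let _ , _ , a≡ = ∈L⇒g a∈L in subst (0 <_) (sym (trans a≡ (+-comm _ 1))) z<s

  open Count S?

  ν : ℕ
  ν = count (suc F)

  isNu : IsNu S F ν
  isNu = filter S? (downFrom (suc F)) , Unique.filter⁺ S? (Unique.downFrom⁺ (suc F)) ,
       (λ x → mk⇔ (λ x∈ → let x∈↓ , sx = ∈-filter⁻ S? x∈ in sx , ≤-pred (∈-downFrom⁻ x∈↓))
                  (λ (sx , x≤F) → ∈-filter⁺ S? (∈-downFrom⁺ (s≤s x≤F)) sx)) ,
       refl

  T : ℕ
  T = 4 * W

  M≡2T : M ≡ 2 * T
  M≡2T = trans M≡8W (*-assoc 2 4 W)

  twos : ∀ u → PowerSum (_≤ c) u (2 * u)
  twos zero = empty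
  twos (suc u) = subst (PowerSum (_≤ c) (suc u)) (expand u) (add 1 (s≤s z≤n) (twos u))
    where expand : ∀ u → 2 * u + 2 ≡ 2 * (1 + u)
          expand = solve-∀

  M*s+k+t∈S : ∀ {k s} → PowerSum (_≤ c) k s → ∀ t → k + t ≤ s → S (M * s + k + t)
  M*s+k+t∈S {k} {s} p t k+t≤s =
    GL⇒S (subst GL (sym (+-assoc (M * s) k t))
                   (PowerSum⇒GL (PowerSum-refine <⇒≤ p (≤⇒≤′ (m≤m+n k t)) k+t≤s)))

  -- The blocks M (2u) + [u, 2u] and M (2u + 1) + [u + 1, 2u + 1] lie in S, each of size u + 1.
  count-below : ∀ u → u ≤ T → u * (1 + u) ≤ count (M * (2 * u))
  count-below zero _ = z≤n
  count-below (suc u) 1+u≤T = begin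
    suc u * (1 + suc u)                 ≡⟨ expand u ⟩
    u * (1 + u) + suc u + suc u         ≤⟨ +-monoˡ-≤ (suc u) (+-monoˡ-≤ (suc u) ih) ⟩
    count (M * (2 * u)) + suc u + suc u ≤⟨ +-monoˡ-≤ (suc u) (+-monoˡ-≤ (suc u) M[2u]≤b₀) ⟩
    count b₀ + suc u + suc u            ≤⟨ +-monoˡ-≤ (suc u) (count-interval b₀ (suc u) even-block) ⟩
    count (b₀ + suc u) + suc u          ≤⟨ +-monoˡ-≤ (suc u) (count-mono b₀+1+u≤b₁) ⟩
    count b₁ + suc u                    ≤⟨ count-interval b₁ (suc u) odd-block ⟩
    count (b₁ + suc u)                  ≤⟨ count-mono b₁+1+u≤M[2+2u] ⟩
    count (M * (2 * suc u))             ∎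
    where
      open ≤-Reasoning
      expand : ∀ u → suc u * (1 + suc u) ≡ u * (1 + u) + suc u + suc u
      expand = solve-∀

      b₀ b₁ : ℕ
      b₀ = M * (2 * u) + u
      b₁ = M * (2 * u + 1) + suc u

      ih : u * (1 + u) ≤ count (M * (2 * u))
      ih = count-below u (<⇒≤ 1+u≤T)

      M[2u]≤b₀ : count (M * (2 * u)) ≤ count b₀
      M[2u]≤b₀ = count-mono (m≤m+n (M * (2 * u)) u)

      2+2u≤M : 2 * suc u ≤ M
      2+2u≤M = subst (2 * suc u ≤_) (sym M≡2T) (*-monoʳ-≤ 2 1+u≤T)

      even-block : ∀ t → t < suc u → S (b₀ + t)
      even-block t t≤u =
        M*s+k+t∈S (twos u) t (subst (u + t ≤_) (2u≡ u) (+-monoʳ-≤ u (≤-pred t≤u)))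
        where 2u≡ : ∀ u → u + u ≡ 2 * u
              2u≡ = solve-∀

      odd-block : ∀ t → t < suc u → S (b₁ + t)
      odd-block t t≤u =
        M*s+k+t∈S (add 0 z≤n (twos u)) t
          (subst (suc u + t ≤_) (2u+1≡ u) (+-monoʳ-≤ (suc u) (≤-pred t≤u)))
        where 2u+1≡ : ∀ u → suc u + u ≡ 2 * u + 1
              2u+1≡ = solve-∀

      b₀+1+u≤b₁ : b₀ + suc u ≤ b₁
      b₀+1+u≤b₁ =
        ≤-trans (+-monoˡ-≤ (suc u) (+-monoʳ-≤ (M * (2 * u)) u≤M)) (≤-reflexive (regroup M u))
        where
          u≤M : u ≤ M
          u≤M = ≤-trans (≤-trans (n≤1+n u) (m≤m+n (suc u) _)) 2+2u≤M
          regroup : ∀ m u → m * (2 * u) + m + suc u ≡ m * (2 * u + 1) + suc u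
          regroup = solve-∀

      b₁+1+u≤M[2+2u] : b₁ + suc u ≤ M * (2 * suc u)
      b₁+1+u≤M[2+2u] =
        ≤-trans (≤-reflexive (regroup₁ M u))
          (≤-trans (+-monoʳ-≤ (M * (2 * u + 1)) 2+2u≤M) (≤-reflexive (regroup₂ M u)))
        where
          regroup₁ : ∀ m u → m * (2 * u + 1) + suc u + suc u ≡ m * (2 * u + 1) + 2 * suc u
          regroup₁ = solve-∀
          regroup₂ : ∀ m u → m * (2 * u + 1) + m ≡ m * (2 * suc u)
          regroup₂ = solve-∀

  T[1+T]≤ν : T * (1 + T) ≤ ν
  T[1+T]≤ν =
    ≤-trans (count-below T ≤-refl) (count-mono (subst (λ e → M * e ≤ suc F) M≡2T M*M≤1+F))
    where
      M*M≤1+F : M * M ≤ suc F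
      M*M≤1+F = ≤-trans (*-monoʳ-≤ M (m≤m+n M 3)) (≤-trans (m≤m+n _ 3) (n≤1+n _))

  wilf : F + 1 ≤ suc c * ν
  wilf = begin
    F + 1                             ≡⟨ cong (λ e → e * (e + 3) + 3 + 1) M≡2T ⟩
    2 * T * (2 * T + 3) + 3 + 1       ≤⟨ quadratic T 3≤T ⟩
    5 * (T * (1 + T))                 ≤⟨ *-mono-≤ 5≤1+c T[1+T]≤ν ⟩
    suc c * ν                         ∎
    where
      open ≤-Reasoning
      3≤T : 3 ≤ T
      3≤T = ≤-trans 3≤W (m≤m+n W _)
      5≤1+c : 5 ≤ suc c
      5≤1+c = s≤s (s≤s (s≤s (s≤s (≤-trans (s≤s z≤n) (m≤n+m r n′)))))
      quadratic : ∀ t → 3 ≤ t → 2 * t * (2 * t + 3) + 3 + 1 ≤ 5 * (t * (1 + t))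
      quadratic 1 (s≤s ())
      quadratic 2 (s≤s (s≤s ()))
      quadratic (suc (suc (suc w))) _ =
        ≤-trans (m≤m+n _ (2 + 5 * w + w * w)) (≤-reflexive (expand w))
        where expand : ∀ w → 2 * (3 + w) * (2 * (3 + w) + 3) + 3 + 1 + (2 + 5 * w + w * w)
                             ≡ 5 * ((3 + w) * (1 + (3 + w)))
              expand = solve-∀

theorem9 : (n r : ℕ) → 2 < n → 1 ≤ r → 2 ^ r + 1 < 2 ^ n →
    Σ ℕ λ F → Σ ℕ λ e → Σ ℕ λ ν →
    IsFrobenius (P r n) F × IsEmbeddingDimension (P r n) e ×
    IsNu (P r n) F ν × F + 1 ≤ e * ν
theorem9 (suc (suc (suc n′))) (suc r′) (s≤s (s≤s (s≤s _))) (s≤s _) _ =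
  F , suc c , ν , frobenius , embedding-dimension , isNu , wilf
  where open Semigroup r′ n′
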